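{- Let $G$ be a connected trivially perfect graph on $m$ edges. Then $\delta(\mathcal{A}(G))\le 2m$.
   Context: All graphs are finite and simple. For a connected graph $G=(V,E)$, a search tree on $G$ is a rooted tree with vertex set $V$ defined recursively: its root is some vertex $r\in V$, and $r$ is joined to the roots of search trees on each connected component of $G-r$. The tubes of a search tree are the vertex sets of its subtrees. Two search trees on $G$ are related by a rotation if their sets of tubes have symmetric difference of size exactly two. The graph associahedron $\mathcal{A}(G)$ is a polytope whose skeleton is isomorphic to the graph on search trees of $G$ with adjacency given by rotations; $\delta(\mathcal{A}(G))$ is the diameter of this graph. A graph is trivially perfect if it can be built recursively from single vertices by (i) adding a new vertex adjacent to all existing vertices and (ii) taking disjoint unions of two trivially perfect graphs. -}

module Defs where

open import Data.Nat using (ℕ; zero; suc; _≤_; _*_; _<ᵇ_)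
open import Data.Bool using (Bool; true; false; if_then_else_; _∧_)
open import Data.Fin using (Fin; toℕ)
open import Data.Fin.Subset using (Subset; _∈_; _∉_; _⊆_; _∪_; _∩_; _─_; ⁅_⁆; ⊤; ⊥; Empty)
open import Data.List using (List; []; _∷_; map; allFin)
open import Data.Nat.ListAction using (sum)
open import Data.List.Relation.Unary.All using (All)
open import Data.List.Relation.Unary.Any using (Any)
open import Data.List.Relation.Unary.AllPairs using (AllPairs)
open import Data.Product using (Σ; ∃; _×_; _,_)
open import Data.Sum using (_⊎_)
open import Relation.Binary.PropositionalEquality using (_≡_; _≢_)
open import Relation.Nullary using (¬_)
open import Function.Bundles using (_⇔_)

record SimpleGraph (n : ℕ) : Set where
  field
    adj   : Fin n → Fin n → Bool
    sym   : ∀ x y → adj x y ≡ adj y x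
    irrefl : ∀ x → adj x x ≡ false
open SimpleGraph public

numEdges : ∀ {n} → SimpleGraph n → ℕ
numEdges {n} G =
  sum (map (λ i → sum (map (λ j → if adj G i j ∧ (toℕ i <ᵇ toℕ j) then 1 else 0)
                           (allFin n)))
           (allFin n))

data Walk {n} (G : SimpleGraph n) (S : Subset n) : Fin n → Fin n → Set where
  here : ∀ {x} → x ∈ S → Walk G S x x
  step : ∀ {x y z} → x ∈ S → adj G x y ≡ true → Walk G S y z → Walk G S x z

Connected : ∀ {n} → SimpleGraph n → Subset n → Set
Connected G S = (∃ λ x → x ∈ S) × (∀ x y → x ∈ S → y ∈ S → Walk G S x y)

Component : ∀ {n} → SimpleGraph n → Subset n → Subset n → Set
Component G T C =
  C ⊆ T × Connected G C × (∀ u v → u ∈ C → v ∈ T → adj G u v ≡ true → v ∈ C)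

-- Trivially perfect graphs, via the recursive construction on vertex sets:
-- TP S means G[S] is trivially perfect.

data TP {n} (G : SimpleGraph n) : Subset n → Set where
  single : ∀ v → TP G ⁅ v ⁆
  cone   : ∀ S v → v ∉ S → TP G S → (∀ u → u ∈ S → adj G v u ≡ true) →
           TP G (S ∪ ⁅ v ⁆)
  union  : ∀ A B → Empty (A ∩ B) →
           (∀ a b → a ∈ A → b ∈ B → adj G a b ≡ false) →
           TP G A → TP G B → TP G (A ∪ B)

TriviallyPerfect : ∀ {n} → SimpleGraph n → Set
TriviallyPerfect G = TP G ⊤

data RTree (n : ℕ) : Set where
  node : Fin n → List (RTree n) → RTree n

mutual
  verts : ∀ {n} → RTree n → Subset n
  verts (node r ts) = ⁅ r ⁆ ∪ vertsList ts

  vertsList : ∀ {n} → List (RTree n) → Subset n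
  vertsList [] = ⊥
  vertsList (t ∷ ts) = verts t ∪ vertsList ts

data IsSearchTree {n} (G : SimpleGraph n) : Subset n → RTree n → Set where
  node : ∀ {S} r ts → r ∈ S →
         All (λ c → Component G (S ─ ⁅ r ⁆) (verts c) × IsSearchTree G (verts c) c) ts →
         (∀ v → v ∈ (S ─ ⁅ r ⁆) → Any (λ c → v ∈ verts c) ts) →
         AllPairs (λ c d → Empty (verts c ∩ verts d)) ts →
         IsSearchTree G S (node r ts)

data IsTube {n} : RTree n → Subset n → Set where
  root  : ∀ t → IsTube t (verts t)
  child : ∀ {r ts X} → Any (λ c → IsTube c X) ts → IsTube (node r ts) X

InSymDiff : ∀ {n} → RTree n → RTree n → Subset n → Set
InSymDiff t t' Z = (IsTube t Z × ¬ IsTube t' Z) ⊎ (IsTube t' Z × ¬ IsTube t Z)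

Rotation : ∀ {n} → RTree n → RTree n → Set
Rotation {n} t t' = Σ (Subset n) λ X → Σ (Subset n) λ Y →
  X ≢ Y × (∀ Z → InSymDiff t t' Z ⇔ (Z ≡ X ⊎ Z ≡ Y))

data RotPath {n} (G : SimpleGraph n) : ℕ → RTree n → RTree n → Set where
  done : ∀ {t} → RotPath G zero t t
  step : ∀ {k t u v} → Rotation t u → IsSearchTree G ⊤ u →
         RotPath G k u v → RotPath G (suc k) t v

DiameterAtMost : ∀ {n} → SimpleGraph n → ℕ → Set
DiameterAtMost G d = ∀ t t' → IsSearchTree G ⊤ t → IsSearchTree G ⊤ t' →
  ∃ λ k → k ≤ d × RotPath G k t t'

-- For a vertex set S, let arcs S be twice the number of edges of G[S]. A connected trivially
-- perfect graph is a single vertex or has a universal vertex w. In a search tree, w can be rotated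
-- up to the root in at most deg w rotations, each one pulling w above one of its neighbours. Once
-- two search trees both have root w, their subtrees are search trees on the components of S - w,
-- which are again trivially perfect, and are matched by induction. Hence two search trees are at
-- most 2 deg w + arcs (S - w) ≤ arcs S rotations apart.

module Submission where

open import Data.Bool using (Bool; true; false; if_then_else_; _∧_; _∨_)
open import Data.Bool.Properties using (∧-zeroʳ; T-≡) renaming (_≟_ to _≟ᵇ_)
open import Data.Empty using (⊥-elim)
open import Data.Fin using (Fin; toℕ; _≟_)
open import Data.Fin.Properties using (any?; toℕ-injective)
open import Data.Fin.Subset
  using (Subset; _∈_; _∉_; _⊆_; _∪_; _∩_; _─_; _-_; ⁅_⁆; ⊤; Empty; inside; outside)
open import Data.Fin.Subset.Properties
  using (x∈p∪q⁻; x∈p∪q⁺; x∈p∩q⁻; x∈p∩q⁺; x∈⁅x⁆; x∈⁅y⁆⇒x≡y; ∉⊥; ⊆-antisym; ∪-identityʳ; ∪-comm; x∈p∧x≢y⇒x∈p-y; _∈?_)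
open import Data.List using (List; []; _∷_; _++_; map; allFin; filter)
open import Data.List.Properties using (++-assoc)
open import Data.List.Membership.Propositional using (find; lose) renaming (_∈_ to _∈ₗ_)
open import Data.List.Membership.Propositional.Properties using (∈-allFin)
open import Data.List.Relation.Unary.All as All using (All; []; _∷_)
import Data.List.Relation.Unary.All.Properties as All
open import Data.List.Relation.Unary.Any as Any using (Any; here; there)
import Data.List.Relation.Unary.Any.Properties as Any
open import Data.List.Relation.Unary.AllPairs as AllPairs using (AllPairs; []; _∷_)
import Data.List.Relation.Unary.AllPairs.Properties as AllPairs
open import Data.List.Relation.Ternary.Interleaving.Propositional
  using (Interleaving; []; consˡ; consʳ; toPermutation)
open import Data.List.Relation.Ternary.Interleaving.Propositional.Properties
  using (++-linear; filter⁺)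
open import Data.List.Relation.Binary.Permutation.Propositional using (↭-sym)
open import Data.List.Relation.Binary.Permutation.Propositional.Properties using (Any-resp-↭; All-resp-↭)
open import Data.Nat using (ℕ; zero; suc; _+_; _*_; _≤_; _<ᵇ_; z≤n; s≤s)
open import Data.Nat.ListAction using (sum)
open import Data.Nat.Properties
  using (≤-refl; ≤-trans; ≤-reflexive; +-mono-≤; +-monoʳ-≤; +-monoˡ-≤; +-comm; +-assoc; +-identityʳ;
         m≤m+n; m≤n+m; <⇒<ᵇ; <-cmp; +-commutativeSemigroup; module ≤-Reasoning)
open import Algebra.Properties.CommutativeSemigroup +-commutativeSemigroup using (interchange)
open import Data.Product using (∃; _×_; _,_; proj₁; proj₂)
open import Data.Sum using (_⊎_; inj₁; inj₂; [_,_]′)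
open import Data.Vec as Vec using (lookup)
open import Data.Vec.Properties using ([]=⇒lookup; lookup⇒[]=; lookup-zipWith; lookup-replicate)
open import Function.Base using (_∘_; case_of_)
open import Function.Bundles using (_⇔_; mk⇔; module Equivalence)
open import Relation.Binary.Definitions using (tri<; tri≈; tri>)
open import Relation.Binary.PropositionalEquality
open import Relation.Nullary using (¬_; Dec; yes; no; ¬?; _×-dec_)
open import Relation.Nullary.Decidable using (⌊_⌋)

open import Defs hiding (sym)
open Equivalence using (to; from)

x∈p─q⁻ : ∀ {n} {x : Fin n} (p q : Subset n) → x ∈ p ─ q → x ∈ p × x ∉ q
x∈p─q⁻ (_ Vec.∷ p) (_ Vec.∷ q) (Vec.there x∈) =
  let x∈p , x∉q = x∈p─q⁻ p q x∈ in Vec.there x∈p , λ { (Vec.there x∈q) → x∉q x∈q }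
x∈p─q⁻ (inside Vec.∷ p) (outside Vec.∷ q) Vec.here = Vec.here , λ ()

module _ {n : ℕ} where

  x∈p-y⁻ : ∀ {p : Subset n} {x y} → x ∈ p - y → x ∈ p × x ≢ y
  x∈p-y⁻ {p} {y = y} x∈ =
    let x∈p , x∉y = x∈p─q⁻ p ⁅ y ⁆ x∈ in x∈p , λ { refl → x∉y (x∈⁅x⁆ y) }

  x∈p∪q⁺ˡ : ∀ {x : Fin n} {p q} → x ∈ p → x ∈ p ∪ q
  x∈p∪q⁺ˡ x∈p = x∈p∪q⁺ (inj₁ x∈p)

  x∈p∪q⁺ʳ : ∀ {x : Fin n} {p q} → x ∈ q → x ∈ p ∪ q
  x∈p∪q⁺ʳ x∈q = x∈p∪q⁺ (inj₂ x∈q)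

  Subsingleton : Subset n → Set
  Subsingleton S = ∀ x y → x ∈ S → y ∈ S → x ≡ y

  only-element : ∀ {S w} → ¬ (∃ λ x → x ∈ S × x ≢ w) → Subsingleton S
  only-element {S} {w} no-other x y x∈ y∈ = trans (is-w x x∈) (sym (is-w y y∈))
    where
    is-w : ∀ x → x ∈ S → x ≡ w
    is-w x x∈ with x ≟ w
    ... | yes x≡w = x≡w
    ... | no x≢w  = ⊥-elim (no-other (x , x∈ , x≢w))

module _ {a p} {A : Set a} {P : A → Set p} {ds es cs : List A} (split : Interleaving ds es cs) where

  Any-interleaving⁻ : Any P cs → Any P ds ⊎ Any P es
  Any-interleaving⁻ = Any.++⁻ ds ∘ Any-resp-↭ (toPermutation split)

  Any-interleaving⁺ˡ : Any P ds → Any P cs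
  Any-interleaving⁺ˡ = Any-resp-↭ (↭-sym (toPermutation split)) ∘ Any.++⁺ˡ

  Any-interleaving⁺ʳ : Any P es → Any P cs
  Any-interleaving⁺ʳ = Any-resp-↭ (↭-sym (toPermutation split)) ∘ Any.++⁺ʳ ds

  All-interleaving⁻ˡ : All P cs → All P ds
  All-interleaving⁻ˡ = All.++⁻ˡ ds ∘ All-resp-↭ (toPermutation split)

  All-interleaving⁻ʳ : All P cs → All P es
  All-interleaving⁻ʳ = All.++⁻ʳ ds ∘ All-resp-↭ (toPermutation split)

module _ {a r} {A : Set a} {R : A → A → Set r} where

  AllPairs-interleaving⁻ˡ : ∀ {ds es cs} → Interleaving ds es cs → AllPairs R cs → AllPairs R ds
  AllPairs-interleaving⁻ˡ []           []       = []
  AllPairs-interleaving⁻ˡ (consˡ split) (h ∷ ps) = All-interleaving⁻ˡ split h ∷ AllPairs-interleaving⁻ˡ split ps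
  AllPairs-interleaving⁻ˡ (consʳ split) (_ ∷ ps) = AllPairs-interleaving⁻ˡ split ps

  AllPairs-interleaving⁻ʳ : ∀ {ds es cs} → Interleaving ds es cs → AllPairs R cs → AllPairs R es
  AllPairs-interleaving⁻ʳ []           []       = []
  AllPairs-interleaving⁻ʳ (consˡ split) (_ ∷ ps) = AllPairs-interleaving⁻ʳ split ps
  AllPairs-interleaving⁻ʳ (consʳ split) (h ∷ ps) = All-interleaving⁻ʳ split h ∷ AllPairs-interleaving⁻ʳ split ps

-- Rooted trees, tubes and rotations

module _ {n : ℕ} where

  rootOf : RTree n → Fin n
  rootOf (node r _) = r

  rootOf∈verts : ∀ t → rootOf t ∈ verts t
  rootOf∈verts (node r _) = x∈p∪q⁺ˡ (x∈⁅x⁆ r)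

  x∈vertsList⁻ : ∀ {x} (ts : List (RTree n)) → x ∈ vertsList ts → Any (λ c → x ∈ verts c) ts
  x∈vertsList⁻ []       x∈ = ⊥-elim (∉⊥ x∈)
  x∈vertsList⁻ (t ∷ ts) x∈ with x∈p∪q⁻ (verts t) _ x∈
  ... | inj₁ x∈t  = here x∈t
  ... | inj₂ x∈ts = there (x∈vertsList⁻ ts x∈ts)

  x∈vertsList⁺ : ∀ {x} {ts : List (RTree n)} → Any (λ c → x ∈ verts c) ts → x ∈ vertsList ts
  x∈vertsList⁺ (here x∈t)  = x∈p∪q⁺ˡ x∈t
  x∈vertsList⁺ (there x∈ts) = x∈p∪q⁺ʳ (x∈vertsList⁺ x∈ts)

  mutual
    tube⊆verts : ∀ {t : RTree n} {Z} → IsTube t Z → Z ⊆ verts t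
    tube⊆verts (root t)  = λ x∈ → x∈
    tube⊆verts (child a) = λ x∈ → x∈p∪q⁺ʳ (tube⊆vertsList a x∈)

    tube⊆vertsList : ∀ {ts : List (RTree n)} {Z} → Any (λ c → IsTube c Z) ts → Z ⊆ vertsList ts
    tube⊆vertsList (here τ) x∈ = x∈p∪q⁺ˡ (tube⊆verts τ x∈)
    tube⊆vertsList (there a) x∈ = x∈p∪q⁺ʳ (tube⊆vertsList a x∈)

  mutual
    tube-nonempty : ∀ {t : RTree n} {Z} → IsTube t Z → ∃ λ x → x ∈ Z
    tube-nonempty (root t)  = rootOf t , rootOf∈verts t
    tube-nonempty (child a) = tubes-nonempty a

    tubes-nonempty : ∀ {ts : List (RTree n)} {Z} → Any (λ c → IsTube c Z) ts → ∃ λ x → x ∈ Z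
    tubes-nonempty (here τ)  = tube-nonempty τ
    tubes-nonempty (there a) = tubes-nonempty a

  Disjoint : RTree n → RTree n → Set
  Disjoint c d = Empty (verts c ∩ verts d)

  Disjoint⇒∉vertsList : ∀ {c} {ds : List (RTree n)} {x} → All (Disjoint c) ds → x ∈ verts c → x ∉ vertsList ds
  Disjoint⇒∉vertsList c#ds x∈c x∈ds =
    let c#d , x∈d = All.lookupAny c#ds (x∈vertsList⁻ _ x∈ds)
    in  c#d (_ , x∈p∩q⁺ (x∈c , x∈d))

  ∉vertsList-left : ∀ (ls : List (RTree n)) {c rs x} → AllPairs Disjoint (ls ++ c ∷ rs) → x ∈ verts c → x ∉ vertsList ls
  ∉vertsList-left []       _          _   x∈ls = ∉⊥ x∈ls
  ∉vertsList-left (l ∷ ls) (l# ∷ ps) x∈c x∈ls with x∈p∪q⁻ (verts l) _ x∈ls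
  ... | inj₁ x∈l  = All.head (All.++⁻ʳ ls l#) (_ , x∈p∩q⁺ (x∈l , x∈c))
  ... | inj₂ x∈ls = ∉vertsList-left ls ps x∈c x∈ls

  ∉vertsList-right : ∀ (ls : List (RTree n)) {c rs x} → AllPairs Disjoint (ls ++ c ∷ rs) → x ∈ verts c → x ∉ vertsList rs
  ∉vertsList-right []       {c} (c# ∷ _) = Disjoint⇒∉vertsList {c} c#
  ∉vertsList-right (_ ∷ ls) (_ ∷ ps) = ∉vertsList-right ls ps

  SameTubes : RTree n → RTree n → Set
  SameTubes t u = ∀ Z → IsTube t Z ⇔ IsTube u Z

  SameTubes-refl : ∀ {t : RTree n} → SameTubes t t
  SameTubes-refl Z = mk⇔ (λ τ → τ) (λ τ → τ)

  SameTubes-sym : ∀ {t u : RTree n} → SameTubes t u → SameTubes u t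
  SameTubes-sym t≈u Z = mk⇔ (from (t≈u Z)) (to (t≈u Z))

  SameTubes⇒verts≡ : ∀ {t u : RTree n} → SameTubes t u → verts t ≡ verts u
  SameTubes⇒verts≡ {t} {u} t≈u =
    ⊆-antisym (tube⊆verts (to (t≈u _) (root t))) (tube⊆verts (from (t≈u _) (root u)))

  InSymDiff-sym : ∀ {t u : RTree n} {Z} → InSymDiff t u Z → InSymDiff u t Z
  InSymDiff-sym (inj₁ d) = inj₂ d
  InSymDiff-sym (inj₂ d) = inj₁ d

  InSymDiff-respˡ : ∀ {t t′ u : RTree n} → SameTubes t t′ → ∀ {Z} → InSymDiff t u Z → InSymDiff t′ u Z
  InSymDiff-respˡ t≈t′ (inj₁ (τ , ¬υ)) = inj₁ (to (t≈t′ _) τ , ¬υ)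
  InSymDiff-respˡ t≈t′ (inj₂ (υ , ¬τ)) = inj₂ (υ , λ τ → ¬τ (from (t≈t′ _) τ))

  Rotation-sym : ∀ {t u : RTree n} → Rotation t u → Rotation u t
  Rotation-sym (X , Y , X≢Y , rot) =
    X , Y , X≢Y , λ Z → mk⇔ (to (rot Z) ∘ InSymDiff-sym) (InSymDiff-sym ∘ from (rot Z))

  Rotation-respˡ : ∀ {t t′ u : RTree n} → SameTubes t t′ → Rotation t u → Rotation t′ u
  Rotation-respˡ t≈t′ (X , Y , X≢Y , rot) =
    X , Y , X≢Y , λ Z → mk⇔ (to (rot Z) ∘ InSymDiff-respˡ (SameTubes-sym t≈t′))
                            (InSymDiff-respˡ t≈t′ ∘ from (rot Z))

  Rotation-respʳ : ∀ {t u u′ : RTree n} → SameTubes u u′ → Rotation t u → Rotation t u′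
  Rotation-respʳ u≈u′ = Rotation-sym ∘ Rotation-respˡ u≈u′ ∘ Rotation-sym

  data ChildTube (r : Fin n) (ls : List (RTree n)) (c : RTree n) (rs : List (RTree n)) (Z : Subset n) : Set where
    whole : Z ≡ verts (node r (ls ++ c ∷ rs)) → ChildTube r ls c rs Z
    left  : Any (λ d → IsTube d Z) ls → ChildTube r ls c rs Z
    mid   : IsTube c Z → ChildTube r ls c rs Z
    right : Any (λ d → IsTube d Z) rs → ChildTube r ls c rs Z

  childTube : ∀ {r : Fin n} ls {c rs Z} → IsTube (node r (ls ++ c ∷ rs)) Z → ChildTube r ls c rs Z
  childTube ls (root _) = whole refl
  childTube ls (child a) with Any.++⁻ ls a
  ... | inj₁ τ         = left τ
  ... | inj₂ (here τ)  = mid τ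
  ... | inj₂ (there τ) = right τ

  tube-mid : ∀ {r : Fin n} ls {c rs Z} → IsTube c Z → IsTube (node r (ls ++ c ∷ rs)) Z
  tube-mid ls τ = child (Any.++⁺ʳ ls (here τ))

  -- The tubes outside the rotated subtree are untouched.
  Rotation-child : ∀ {r : Fin n} ls {t t′} rs → verts t ≡ verts t′ → r ∉ verts t →
    (∀ {x} → x ∈ verts t → x ∉ vertsList ls) → (∀ {x} → x ∈ verts t → x ∉ vertsList rs) →
    Rotation t t′ → Rotation (node r (ls ++ t ∷ rs)) (node r (ls ++ t′ ∷ rs))
  Rotation-child {r} ls {t} {t′} rs t≡t′ r∉t t#ls t#rs (X , Y , X≢Y , rot) =
    X , Y , X≢Y , λ Z → mk⇔ (to (rot Z) ∘ inSymDiff⁻) (inSymDiff⁺ ∘ from (rot Z))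
    where
    T : RTree n → RTree n
    T c = node r (ls ++ c ∷ rs)

    T-verts : ∀ {c c′} → verts c ≡ verts c′ → verts (T c) ≡ verts (T c′)
    T-verts {c} {c′} c≡c′ = cong (⁅ r ⁆ ∪_) (go ls)
      where
      go : ∀ ks → vertsList (ks ++ c ∷ rs) ≡ vertsList (ks ++ c′ ∷ rs)
      go []       = cong (_∪ vertsList rs) c≡c′
      go (k ∷ ks) = cong (verts k ∪_) (go ks)

    only-mid : ∀ {c c′ Z} → verts c ≡ verts c′ → IsTube (T c) Z → ¬ IsTube (T c′) Z →
      IsTube c Z × ¬ IsTube c′ Z
    only-mid c≡c′ τ ¬τ′ with childTube ls τ
    ... | whole refl = ⊥-elim (¬τ′ (subst (IsTube _) (sym (T-verts c≡c′)) (root _)))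
    ... | left τ     = ⊥-elim (¬τ′ (child (Any.++⁺ˡ τ)))
    ... | mid τ      = τ , λ τ′ → ¬τ′ (tube-mid ls τ′)
    ... | right τ    = ⊥-elim (¬τ′ (child (Any.++⁺ʳ ls (there τ))))

    lift-mid : ∀ {c c′ Z} → verts c ≡ verts t → IsTube c Z → ¬ IsTube c′ Z →
      IsTube (T c) Z × ¬ IsTube (T c′) Z
    lift-mid {c} {c′} {Z} c≡t τ ¬τ′ = tube-mid ls τ , not-in-T
      where
      x∈t : ∀ {x} → x ∈ Z → x ∈ verts t
      x∈t x∈Z = subst (_ ∈_) c≡t (tube⊆verts τ x∈Z)
      not-in-T : ¬ IsTube (T c′) Z
      not-in-T τ′ with childTube ls τ′
      ... | whole refl = r∉t (x∈t (rootOf∈verts (T c′)))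
      ... | left υ     = let _ , x∈Z = tube-nonempty τ in t#ls (x∈t x∈Z) (tube⊆vertsList υ x∈Z)
      ... | mid υ      = ¬τ′ υ
      ... | right υ    = let _ , x∈Z = tube-nonempty τ in t#rs (x∈t x∈Z) (tube⊆vertsList υ x∈Z)

    inSymDiff⁻ : ∀ {Z} → InSymDiff (T t) (T t′) Z → InSymDiff t t′ Z
    inSymDiff⁻ (inj₁ (τ , ¬τ′)) = inj₁ (only-mid t≡t′ τ ¬τ′)
    inSymDiff⁻ (inj₂ (τ′ , ¬τ)) = inj₂ (only-mid (sym t≡t′) τ′ ¬τ)

    inSymDiff⁺ : ∀ {Z} → InSymDiff t t′ Z → InSymDiff (T t) (T t′) Z
    inSymDiff⁺ (inj₁ (τ , ¬τ′)) = inj₁ (lift-mid refl τ ¬τ′)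
    inSymDiff⁺ (inj₂ (τ′ , ¬τ)) = inj₂ (lift-mid (sym t≡t′) τ′ ¬τ)

module _ {n : ℕ} {ds es cs : List (RTree n)} (split : Interleaving ds es cs) where

  vertsList-interleaving⁻ : ∀ {x} → x ∈ vertsList cs → x ∈ vertsList ds ⊎ x ∈ vertsList es
  vertsList-interleaving⁻ x∈cs with Any-interleaving⁻ split (x∈vertsList⁻ cs x∈cs)
  ... | inj₁ x∈ds = inj₁ (x∈vertsList⁺ x∈ds)
  ... | inj₂ x∈es = inj₂ (x∈vertsList⁺ x∈es)

  vertsList-interleaving⁺ˡ : vertsList ds ⊆ vertsList cs
  vertsList-interleaving⁺ˡ = x∈vertsList⁺ ∘ Any-interleaving⁺ˡ split ∘ x∈vertsList⁻ ds

  vertsList-interleaving⁺ʳ : vertsList es ⊆ vertsList cs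
  vertsList-interleaving⁺ʳ = x∈vertsList⁺ ∘ Any-interleaving⁺ʳ split ∘ x∈vertsList⁻ es

interleaving-disjoint : ∀ {n} {ds es cs : List (RTree n)} → Interleaving ds es cs → AllPairs Disjoint cs →
  ∀ {x} → x ∈ vertsList ds → x ∉ vertsList es
interleaving-disjoint [] _ x∈ds _ = ∉⊥ x∈ds
interleaving-disjoint {ds = d ∷ _} (consˡ split) (d# ∷ ps) x∈ds x∈es with x∈p∪q⁻ (verts d) _ x∈ds
... | inj₁ x∈d  = Disjoint⇒∉vertsList {c = d} (All-interleaving⁻ʳ split d#) x∈d x∈es
... | inj₂ x∈ds = interleaving-disjoint split ps x∈ds x∈es
interleaving-disjoint {es = e ∷ _} (consʳ split) (e# ∷ ps) x∈ds x∈es with x∈p∪q⁻ (verts e) _ x∈es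
... | inj₁ x∈e  = Disjoint⇒∉vertsList {c = e} (All-interleaving⁻ˡ split e#) x∈e x∈ds
... | inj₂ x∈es = interleaving-disjoint split ps x∈ds x∈es

-- The only tubes that change are X = verts (node u cs) and Y = verts (node a ds).
Rotation-promote : ∀ {n} {a u : Fin n} {ds es cs} → a ≢ u → a ∉ vertsList cs → u ∉ vertsList cs →
  Interleaving ds es cs → Rotation (node a (node u cs ∷ [])) (node u (node a ds ∷ es))
Rotation-promote {n} {a} {u} {ds} {es} {cs} a≢u a∉cs u∉cs split =
  X , Y , (λ X≡Y → a∉X (subst (a ∈_) (sym X≡Y) a∈Y)) , λ Z → mk⇔ (InSymDiff⇒XY Z) (XY⇒InSymDiff Z)
  where
  L R : RTree n
  L = node a (node u cs ∷ [])
  R = node u (node a ds ∷ es)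
  X Y : Subset n
  X = verts (node u cs)
  Y = verts (node a ds)

  a∈Y : a ∈ Y
  a∈Y = rootOf∈verts (node a ds)
  u∈X : u ∈ X
  u∈X = rootOf∈verts (node u cs)

  a∉X : a ∉ X
  a∉X a∈X with x∈p∪q⁻ ⁅ u ⁆ _ a∈X
  ... | inj₁ a∈u  = a≢u (x∈⁅y⁆⇒x≡y u a∈u)
  ... | inj₂ a∈cs = a∉cs a∈cs

  u∉Y : u ∉ Y
  u∉Y u∈Y with x∈p∪q⁻ ⁅ a ⁆ _ u∈Y
  ... | inj₁ u∈a  = a≢u (sym (x∈⁅y⁆⇒x≡y a u∈a))
  ... | inj₂ u∈ds = u∉cs (vertsList-interleaving⁺ˡ split u∈ds)

  L≡R : verts L ≡ verts R
  L≡R = ⊆-antisym L⊆R R⊆L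
    where
    L⊆R : verts L ⊆ verts R
    L⊆R x∈ with x∈p∪q⁻ ⁅ a ⁆ _ x∈
    ... | inj₁ x∈a = x∈p∪q⁺ʳ (x∈p∪q⁺ˡ (x∈p∪q⁺ˡ x∈a))
    ... | inj₂ x∈′ with x∈p∪q⁻ X _ x∈′
    ... | inj₂ x∈⊥ = ⊥-elim (∉⊥ x∈⊥)
    ... | inj₁ x∈X with x∈p∪q⁻ ⁅ u ⁆ _ x∈X
    ... | inj₁ x∈u  = x∈p∪q⁺ˡ x∈u
    ... | inj₂ x∈cs with vertsList-interleaving⁻ split x∈cs
    ... | inj₁ x∈ds = x∈p∪q⁺ʳ (x∈p∪q⁺ˡ (x∈p∪q⁺ʳ x∈ds))
    ... | inj₂ x∈es = x∈p∪q⁺ʳ (x∈p∪q⁺ʳ x∈es)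
    R⊆L : verts R ⊆ verts L
    R⊆L x∈ with x∈p∪q⁻ ⁅ u ⁆ _ x∈
    ... | inj₁ x∈u = x∈p∪q⁺ʳ (x∈p∪q⁺ˡ (x∈p∪q⁺ˡ x∈u))
    ... | inj₂ x∈′ with x∈p∪q⁻ Y _ x∈′
    ... | inj₂ x∈es = x∈p∪q⁺ʳ (x∈p∪q⁺ˡ (x∈p∪q⁺ʳ (vertsList-interleaving⁺ʳ split x∈es)))
    ... | inj₁ x∈Y with x∈p∪q⁻ ⁅ a ⁆ _ x∈Y
    ... | inj₁ x∈a  = x∈p∪q⁺ˡ x∈a
    ... | inj₂ x∈ds = x∈p∪q⁺ʳ (x∈p∪q⁺ˡ (x∈p∪q⁺ʳ (vertsList-interleaving⁺ˡ split x∈ds)))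

  InSymDiff⇒XY : ∀ Z → InSymDiff L R Z → Z ≡ X ⊎ Z ≡ Y
  InSymDiff⇒XY Z (inj₁ (root _ , ¬υ))                 = ⊥-elim (¬υ (subst (IsTube R) (sym L≡R) (root R)))
  InSymDiff⇒XY Z (inj₁ (child (here (root _)) , ¬υ))  = inj₁ refl
  InSymDiff⇒XY Z (inj₁ (child (here (child τ)) , ¬υ)) with Any-interleaving⁻ split τ
  ... | inj₁ τ∈ds = ⊥-elim (¬υ (child (here (child τ∈ds))))
  ... | inj₂ τ∈es = ⊥-elim (¬υ (child (there τ∈es)))
  InSymDiff⇒XY Z (inj₂ (root _ , ¬τ))                  = ⊥-elim (¬τ (subst (IsTube L) L≡R (root L)))
  InSymDiff⇒XY Z (inj₂ (child (here (root _)) , ¬τ))   = inj₂ refl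
  InSymDiff⇒XY Z (inj₂ (child (here (child υ)) , ¬τ))  = ⊥-elim (¬τ (child (here (child (Any-interleaving⁺ˡ split υ)))))
  InSymDiff⇒XY Z (inj₂ (child (there υ) , ¬τ))         = ⊥-elim (¬τ (child (here (child (Any-interleaving⁺ʳ split υ)))))

  X∉R : ∀ {Z} → IsTube R Z → Z ≢ X
  X∉R (root _)                 Z≡X  = a∉X (subst (a ∈_) Z≡X (x∈p∪q⁺ʳ (x∈p∪q⁺ˡ a∈Y)))
  X∉R (child (here (root _)))  Y≡X  = a∉X (subst (a ∈_) Y≡X a∈Y)
  X∉R (child (here (child τ))) refl = u∉cs (vertsList-interleaving⁺ˡ split (tube⊆vertsList τ u∈X))
  X∉R (child (there τ))        refl = u∉cs (vertsList-interleaving⁺ʳ split (tube⊆vertsList τ u∈X))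

  Y∉L : ∀ {Z} → IsTube L Z → Z ≢ Y
  Y∉L (root _)                 Z≡Y  = u∉Y (subst (u ∈_) Z≡Y (x∈p∪q⁺ʳ (x∈p∪q⁺ˡ u∈X)))
  Y∉L (child (here (root _)))  X≡Y  = a∉X (subst (a ∈_) (sym X≡Y) a∈Y)
  Y∉L (child (here (child τ))) refl = a∉cs (tube⊆vertsList τ a∈Y)

  XY⇒InSymDiff : ∀ Z → Z ≡ X ⊎ Z ≡ Y → InSymDiff L R Z
  XY⇒InSymDiff Z (inj₁ refl) = inj₁ (child (here (root _)) , λ υ → X∉R υ refl)
  XY⇒InSymDiff Z (inj₂ refl) = inj₂ (child (here (root _)) , λ τ → Y∉L τ refl)

-- Counting arcs

ind : Bool → ℕ
ind b = if b then 1 else 0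

module _ {a} {A : Set a} where

  sum-mono-≤ : ∀ (xs : List A) {f g : A → ℕ} → (∀ x → f x ≤ g x) → sum (map f xs) ≤ sum (map g xs)
  sum-mono-≤ []       f≤g = z≤n
  sum-mono-≤ (x ∷ xs) f≤g = +-mono-≤ (f≤g x) (sum-mono-≤ xs f≤g)

  sum-cong : ∀ (xs : List A) {f g : A → ℕ} → (∀ x → f x ≡ g x) → sum (map f xs) ≡ sum (map g xs)
  sum-cong []       f≡g = refl
  sum-cong (x ∷ xs) f≡g = cong₂ _+_ (f≡g x) (sum-cong xs f≡g)

  sum-+ : ∀ (xs : List A) (f g : A → ℕ) →
    sum (map (λ x → f x + g x) xs) ≡ sum (map f xs) + sum (map g xs)
  sum-+ []       f g = refl
  sum-+ (x ∷ xs) f g =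
    trans (cong (f x + g x +_) (sum-+ xs f g)) (interchange (f x) (g x) (sum (map f xs)) (sum (map g xs)))

  ≤-sum : ∀ {xs : List A} {x} (f : A → ℕ) → x ∈ₗ xs → f x ≤ sum (map f xs)
  ≤-sum f (here refl)              = m≤m+n _ _
  ≤-sum {xs = y ∷ _} f (there x∈) = ≤-trans (≤-sum f x∈) (m≤n+m _ (f y))

  sum-zero : ∀ (xs : List A) → sum (map (λ _ → 0) xs) ≡ 0
  sum-zero []       = refl
  sum-zero (_ ∷ xs) = sum-zero xs

sum-swap : ∀ {a b} {A : Set a} {B : Set b} (xs : List A) (ys : List B) (f : A → B → ℕ) →
  sum (map (λ x → sum (map (f x) ys)) xs) ≡ sum (map (λ y → sum (map (λ x → f x y) xs)) ys)
sum-swap []       ys f = sym (sum-zero ys)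
sum-swap (x ∷ xs) ys f =
  trans (cong (sum (map (f x) ys) +_) (sum-swap xs ys f)) (sym (sum-+ ys (f x) _))

∑ : ∀ {n} → (Fin n → ℕ) → ℕ
∑ {n} f = sum (map f (allFin n))

≤-∑ : ∀ {n} (f : Fin n → ℕ) i → f i ≤ ∑ f
≤-∑ f i = ≤-sum f (∈-allFin i)

∑-mono-≤ : ∀ {n} {f g : Fin n → ℕ} → (∀ i → f i ≤ g i) → ∑ f ≤ ∑ g
∑-mono-≤ {n} = sum-mono-≤ (allFin n)

∑-cong : ∀ {n} {f g : Fin n → ℕ} → (∀ i → f i ≡ g i) → ∑ f ≡ ∑ g
∑-cong {n} = sum-cong (allFin n)

∑-+ : ∀ {n} (f g : Fin n → ℕ) → ∑ (λ i → f i + g i) ≡ ∑ f + ∑ g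
∑-+ {n} = sum-+ (allFin n)

∑-swap : ∀ {n} (f : Fin n → Fin n → ℕ) → ∑ (λ i → ∑ (f i)) ≡ ∑ (λ j → ∑ (λ i → f i j))
∑-swap {n} = sum-swap (allFin n) (allFin n)

∑∑-+ : ∀ {n} (f g : Fin n → Fin n → ℕ) →
  ∑ (λ i → ∑ (f i)) + ∑ (λ i → ∑ (g i)) ≡ ∑ (λ i → ∑ (λ j → f i j + g i j))
∑∑-+ f g = trans (sym (∑-+ (λ i → ∑ (f i)) (λ i → ∑ (g i)))) (∑-cong λ i → sym (∑-+ (f i) (g i)))

ind-∧-disjoint : ∀ ai bi aj bj e → ai ∧ bi ≡ false → aj ∧ bj ≡ false →
  ind (ai ∧ aj ∧ e) + ind (bi ∧ bj ∧ e) ≤ ind ((ai ∨ bi) ∧ (aj ∨ bj) ∧ e)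
ind-∧-disjoint true  _     true  _  e refl refl = ≤-reflexive (+-identityʳ (ind e))
ind-∧-disjoint true  _     false _  e refl _    = z≤n
ind-∧-disjoint false false true  _  e _    refl = z≤n
ind-∧-disjoint false true  true  _  e _    refl = z≤n
ind-∧-disjoint false bi    false bj e _    _    = ≤-refl

module _ {n : ℕ} where

  if-≟-self : ∀ (w : Fin n) (x : ℕ) → (if ⌊ w ≟ w ⌋ then x else 0) ≡ x
  if-≟-self w x with w ≟ w
  ... | yes _  = refl
  ... | no w≢w = ⊥-elim (w≢w refl)

  lookup-∉ : ∀ {S : Subset n} {x} → x ∉ S → lookup S x ≡ false
  lookup-∉ {S} {x} x∉S with lookup S x in eq
  ... | true  = ⊥-elim (x∉S (lookup⇒[]= x S eq))
  ... | false = refl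

  lookup-remove : ∀ {S : Subset n} {a j} → j ≢ a → lookup (S - a) j ≡ lookup S j
  lookup-remove {S} {a} {j} j≢a with lookup S j in eq
  ... | true  = []=⇒lookup {xs = S - a} (x∈p∧x≢y⇒x∈p-y (lookup⇒[]= j S eq) j≢a)
  ... | false = lookup-∉ {S = S - a} λ j∈ → case trans (sym ([]=⇒lookup (proj₁ (x∈p-y⁻ {p = S} j∈)))) eq of λ ()

  lookup-remove-self : ∀ {S : Subset n} {a} → lookup (S - a) a ≡ false
  lookup-remove-self {S} {a} = lookup-∉ {S = S - a} (λ a∈ → proj₂ (x∈p-y⁻ {p = S} a∈) refl)

module _ {n} (G : SimpleGraph n) where

  arc : Subset n → Fin n → Fin n → ℕ
  arc S i j = ind (lookup S i ∧ lookup S j ∧ adj G i j)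

  -- Ordered pairs of adjacent vertices of S, i.e. twice the number of edges of G[S].
  arcs : Subset n → ℕ
  arcs S = ∑ λ i → ∑ (arc S i)

  edgeInto : Subset n → Fin n → Fin n → ℕ
  edgeInto S w j = ind (lookup S j ∧ adj G w j)

  degree : Subset n → Fin n → ℕ
  degree S w = ∑ (edgeInto S w)

  degree-remove : ∀ {S a w} → a ∈ S → adj G w a ≡ true → degree (S - a) w + 1 ≤ degree S w
  degree-remove {S} {a} {w} a∈S wa = begin
    degree (S - a) w + 1        ≤⟨ +-monoʳ-≤ (degree (S - a) w) (≤-trans (≤-reflexive (sym (if-≟-self a 1))) (≤-∑ δ a)) ⟩
    degree (S - a) w + ∑ δ      ≡⟨ sym (∑-+ (edgeInto (S - a) w) δ) ⟩
    ∑ (λ j → edgeInto (S - a) w j + δ j) ≤⟨ ∑-mono-≤ pointwise ⟩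
    degree S w                  ∎
    where
    open ≤-Reasoning
    δ : Fin n → ℕ
    δ j = ind ⌊ j ≟ a ⌋
    pointwise : ∀ j → edgeInto (S - a) w j + δ j ≤ edgeInto S w j
    pointwise j with j ≟ a
    ... | yes refl rewrite lookup-remove-self {S = S} {a} | []=⇒lookup a∈S | wa = ≤-refl
    ... | no j≢a   rewrite lookup-remove {S = S} j≢a = ≤-reflexive (+-identityʳ _)

  arcs-remove : ∀ {S w} → w ∈ S → degree S w + degree S w + arcs (S - w) ≤ arcs S
  arcs-remove {S} {w} w∈S = begin
    degree S w + degree S w + arcs (S - w)
      ≤⟨ +-monoˡ-≤ (arcs (S - w)) (+-mono-≤ out-bound in-bound) ⟩
    ∑ (λ i → ∑ (out i)) + ∑ (λ i → ∑ (in′ i)) + arcs (S - w)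
      ≡⟨ cong (_+ arcs (S - w)) (∑∑-+ out in′) ⟩
    ∑ (λ i → ∑ (λ j → out i j + in′ i j)) + arcs (S - w)
      ≡⟨ ∑∑-+ (λ i j → out i j + in′ i j) (arc (S - w)) ⟩
    ∑ (λ i → ∑ (λ j → out i j + in′ i j + arc (S - w) i j))
      ≤⟨ ∑-mono-≤ (λ i → ∑-mono-≤ (pointwise i)) ⟩
    arcs S ∎
    where
    open ≤-Reasoning
    out in′ : Fin n → Fin n → ℕ
    out i j = if ⌊ i ≟ w ⌋ then edgeInto S w j else 0
    in′ i j = if ⌊ j ≟ w ⌋ then edgeInto S w i else 0

    out-bound : degree S w ≤ ∑ (λ i → ∑ (out i))
    out-bound = ≤-trans (≤-reflexive (∑-cong λ j → sym (if-≟-self w (edgeInto S w j)))) (≤-∑ (λ i → ∑ (out i)) w)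

    in-bound : degree S w ≤ ∑ (λ i → ∑ (in′ i))
    in-bound = ∑-mono-≤ λ i → ≤-trans (≤-reflexive (sym (if-≟-self w (edgeInto S w i)))) (≤-∑ (in′ i) w)

    pointwise : ∀ i j → out i j + in′ i j + arc (S - w) i j ≤ arc S i j
    pointwise i j with i ≟ w | j ≟ w
    ... | yes refl | yes refl rewrite irrefl G w | lookup-remove-self {S = S} {w} | []=⇒lookup w∈S = z≤n
    ... | yes refl | no j≢w rewrite lookup-remove-self {S = S} {w} | []=⇒lookup w∈S =
      ≤-reflexive (trans (+-identityʳ _) (+-identityʳ _))
    ... | no i≢w | yes refl rewrite lookup-remove-self {S = S} {w} | []=⇒lookup w∈S
                                   | ∧-zeroʳ (lookup (S - w) i) | SimpleGraph.sym G w i = ≤-reflexive (+-identityʳ _)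
    ... | no i≢w | no j≢w rewrite lookup-remove {S = S} i≢w | lookup-remove {S = S} j≢w = ≤-refl

  arcs-∪ : ∀ {A B} → (∀ {x} → x ∈ A → x ∉ B) → arcs A + arcs B ≤ arcs (A ∪ B)
  arcs-∪ {A} {B} A#B = ≤-trans (≤-reflexive (∑∑-+ (arc A) (arc B))) (∑-mono-≤ λ i → ∑-mono-≤ (pointwise i))
    where
    disjoint : ∀ x → lookup A x ∧ lookup B x ≡ false
    disjoint x with lookup A x in x∈A | lookup B x in x∈B
    ... | true  | true  = ⊥-elim (A#B (lookup⇒[]= x A x∈A) (lookup⇒[]= x B x∈B))
    ... | true  | false = refl
    ... | false | _     = refl

    pointwise : ∀ i j → arc A i j + arc B i j ≤ arc (A ∪ B) i j
    pointwise i j rewrite lookup-zipWith _∨_ i A B | lookup-zipWith _∨_ j A B =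
      ind-∧-disjoint (lookup A i) (lookup B i) (lookup A j) (lookup B j) (adj G i j) (disjoint i) (disjoint j)

  arcs-⊤ : arcs ⊤ ≤ 2 * numEdges G
  arcs-⊤ = begin
    arcs ⊤                                         ≡⟨ ∑-cong (λ i → ∑-cong λ j → arc-⊤ i j) ⟩
    ∑ (λ i → ∑ λ j → ind (adj G i j))              ≤⟨ ∑-mono-≤ (λ i → ∑-mono-≤ (pointwise i)) ⟩
    ∑ (λ i → ∑ λ j → up i j + up j i)              ≡⟨ sym (∑∑-+ up (λ i j → up j i)) ⟩
    numEdges G + ∑ (λ i → ∑ λ j → up j i)          ≡⟨ cong (numEdges G +_) (∑-swap (λ i j → up j i)) ⟩
    numEdges G + numEdges G                        ≡⟨ cong (numEdges G +_) (sym (+-identityʳ _)) ⟩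
    2 * numEdges G                                 ∎
    where
    open ≤-Reasoning
    up : Fin n → Fin n → ℕ
    up i j = ind (adj G i j ∧ (toℕ i <ᵇ toℕ j))

    arc-⊤ : ∀ i j → arc ⊤ i j ≡ ind (adj G i j)
    arc-⊤ i j rewrite lookup-replicate i true | lookup-replicate j true = refl

    pointwise : ∀ i j → ind (adj G i j) ≤ up i j + up j i
    pointwise i j with adj G i j in ij
    ... | false = z≤n
    ... | true with <-cmp (toℕ i) (toℕ j)
    ... | tri< i<j _ _ rewrite to T-≡ (<⇒<ᵇ i<j) = s≤s z≤n
    ... | tri≈ _ i≡j _ with toℕ-injective i≡j
    ... | refl = case trans (sym ij) (irrefl G i) of λ ()
    pointwise i j | true | tri> _ _ j<i rewrite trans (SimpleGraph.sym G j i) ij | to T-≡ (<⇒<ᵇ j<i) =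
      m≤n+m 1 (ind (toℕ i <ᵇ toℕ j))

  arcsList : List (RTree n) → ℕ
  arcsList []       = 0
  arcsList (c ∷ cs) = arcs (verts c) + arcsList cs

  arcsList-≤ : ∀ {cs} → AllPairs Disjoint cs → arcsList cs ≤ arcs (vertsList cs)
  arcsList-≤ {[]}     []        = z≤n
  arcsList-≤ {c ∷ cs} (c# ∷ ps) =
    ≤-trans (+-monoʳ-≤ (arcs (verts c)) (arcsList-≤ ps)) (arcs-∪ (Disjoint⇒∉vertsList {c = c} c#))

Universal : ∀ {n} → SimpleGraph n → Subset n → Fin n → Set
Universal G S w = ∀ x → x ∈ S → x ≢ w → adj G w x ≡ true

module _ {n} {G : SimpleGraph n} where

  adj-sym : ∀ {x y} → adj G x y ≡ true → adj G y x ≡ true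
  adj-sym {x} {y} = trans (SimpleGraph.sym G y x)

  walk-start : ∀ {S x y} → Walk G S x y → x ∈ S
  walk-start (here x∈)     = x∈
  walk-start (step x∈ _ _) = x∈

  walk-mono : ∀ {S T x y} → S ⊆ T → Walk G S x y → Walk G T x y
  walk-mono S⊆T (here x∈)      = here (S⊆T x∈)
  walk-mono S⊆T (step x∈ xy w) = step (S⊆T x∈) xy (walk-mono S⊆T w)

  walk-++ : ∀ {S x y z} → Walk G S x y → Walk G S y z → Walk G S x z
  walk-++ (here _)       w′ = w′
  walk-++ (step x∈ xy w) w′ = step x∈ xy (walk-++ w w′)

  walk-reverse : ∀ {S x y} → Walk G S x y → Walk G S y x
  walk-reverse (here x∈)      = here x∈
  walk-reverse (step x∈ xy w) = walk-++ (walk-reverse w) (step (walk-start w) (adj-sym xy) (here x∈))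

  connected-from : ∀ {S} v → v ∈ S → (∀ y → y ∈ S → Walk G S v y) → Connected G S
  connected-from v v∈ walk = (v , v∈) , λ x y x∈ y∈ → walk-++ (walk-reverse (walk x x∈)) (walk y y∈)

  walk-closed : ∀ {C T C′ x y} → Walk G C x y → C ⊆ T →
    (∀ u v → u ∈ C′ → v ∈ T → adj G u v ≡ true → v ∈ C′) → x ∈ C′ → y ∈ C′
  walk-closed (here _)      C⊆T closed x∈ = x∈
  walk-closed (step _ xy w) C⊆T closed x∈ = walk-closed w C⊆T closed (closed _ _ x∈ (C⊆T (walk-start w)) xy)

  component-unique : ∀ {T C C′ x} → Component G T C → Component G T C′ → x ∈ C → x ∈ C′ → C ≡ C′
  component-unique {x = x} (C⊆ , (_ , walk) , closed) (C′⊆ , (_ , walk′) , closed′) x∈C x∈C′ =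
    ⊆-antisym (λ {y} y∈ → walk-closed (walk x y x∈C y∈) C⊆ closed′ x∈C′)
              (λ {y} y∈ → walk-closed (walk′ x y x∈C′ y∈) C′⊆ closed x∈C)

  component-shrink : ∀ {T T′ C} → Component G T C → C ⊆ T′ → T′ ⊆ T → Component G T′ C
  component-shrink (_ , connected , closed) C⊆T′ T′⊆T =
    C⊆T′ , connected , λ u v u∈ v∈ uv → closed u v u∈ (T′⊆T v∈) uv

  component-nonempty : ∀ {T C} → Component G T C → ∃ λ x → x ∈ C
  component-nonempty (_ , (nonempty , _) , _) = nonempty

  component-∋-universal : ∀ {T a w C} → Universal G T w → w ∈ T - a → Component G (T - a) C → w ∈ C
  component-∋-universal {w = w} universal w∈ C@(C⊆ , _ , closed) with component-nonempty C
  ... | x , x∈C with x ≟ w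
  ... | yes refl = x∈C
  ... | no x≢w   = closed x w x∈C w∈ (adj-sym (universal x (proj₁ (x∈p-y⁻ (C⊆ x∈C))) x≢w))

  SubtreesOn : Subset n → List (RTree n) → Set
  SubtreesOn T = All (λ c → Component G T (verts c) × IsSearchTree G (verts c) c)

  SubtreesOn⇒⊆ : ∀ {T ts} → SubtreesOn T ts → vertsList ts ⊆ T
  SubtreesOn⇒⊆ []                    x∈ = ⊥-elim (∉⊥ x∈)
  SubtreesOn⇒⊆ {ts = t ∷ _} ((C , _) ∷ cs) x∈ with x∈p∪q⁻ (verts t) _ x∈
  ... | inj₁ x∈t  = proj₁ C x∈t
  ... | inj₂ x∈ts = SubtreesOn⇒⊆ cs x∈ts

  root∈ : ∀ {S r ts} → IsSearchTree G S (node r ts) → r ∈ S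
  root∈ (node _ _ r∈ _ _ _) = r∈

  subtrees : ∀ {S r ts} → IsSearchTree G S (node r ts) → SubtreesOn (S - r) ts
  subtrees (node _ _ _ cs _ _) = cs

  subtrees-cover : ∀ {S r ts} → IsSearchTree G S (node r ts) → ∀ v → v ∈ S - r → Any (λ c → v ∈ verts c) ts
  subtrees-cover (node _ _ _ _ cover _) = cover

  subtrees-disjoint : ∀ {S r ts} → IsSearchTree G S (node r ts) → AllPairs Disjoint ts
  subtrees-disjoint (node _ _ _ _ _ disjoint) = disjoint

  vertsList-subtrees : ∀ {S r ts} → IsSearchTree G S (node r ts) → vertsList ts ≡ S - r
  vertsList-subtrees st = ⊆-antisym (SubtreesOn⇒⊆ (subtrees st)) (λ {v} v∈ → x∈vertsList⁺ (subtrees-cover st v v∈))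

  root∉subtrees : ∀ {S r ts} → IsSearchTree G S (node r ts) → r ∉ vertsList ts
  root∉subtrees st r∈ = proj₂ (x∈p-y⁻ (subst (_ ∈_) (vertsList-subtrees st) r∈)) refl

  verts-searchTree : ∀ {S t} → IsSearchTree G S t → verts t ≡ S
  verts-searchTree {S} {node r ts} st = ⊆-antisym ⊆S S⊆
    where
    ⊆S : verts (node r ts) ⊆ S
    ⊆S x∈ with x∈p∪q⁻ ⁅ r ⁆ _ x∈
    ... | inj₁ x∈r  = subst (_∈ S) (sym (x∈⁅y⁆⇒x≡y r x∈r)) (root∈ st)
    ... | inj₂ x∈ts = proj₁ (x∈p-y⁻ (subst (_ ∈_) (vertsList-subtrees st) x∈ts))
    S⊆ : S ⊆ verts (node r ts)
    S⊆ {v} v∈ with v ≟ r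
    ... | yes refl = rootOf∈verts (node r ts)
    ... | no v≢r   = x∈p∪q⁺ʳ (subst (v ∈_) (sym (vertsList-subtrees st)) (x∈p∧x≢y⇒x∈p-y v∈ v≢r))

  searchTree-singleton : ∀ {S t t′} → Subsingleton S →
    IsSearchTree G S t → IsSearchTree G S t′ → t ≡ t′
  searchTree-singleton {S} {node r ts} {node r′ ts′} trivial st st′
    with trivial r r′ (root∈ st) (root∈ st′)
  ... | refl = cong (node r) (trans (no-subtrees st) (sym (no-subtrees st′)))
    where
    no-subtrees : ∀ {us} → IsSearchTree G S (node r us) → us ≡ []
    no-subtrees st″ with subtrees st″
    ... | []          = refl
    ... | (C , _) ∷ _ =
      let x , x∈ = component-nonempty C
          x∈S , x≢r = x∈p-y⁻ (proj₁ C x∈)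
      in  ⊥-elim (x≢r (trivial x r x∈S (root∈ st″)))

  data RotPathOn (S : Subset n) : ℕ → RTree n → RTree n → Set where
    done : ∀ {t} → RotPathOn S zero t t
    step : ∀ {k t u v} → Rotation t u → IsSearchTree G S u → RotPathOn S k u v → RotPathOn S (suc k) t v

  _++ᵣ_ : ∀ {S k l t u v} → RotPathOn S k t u → RotPathOn S l u v → RotPathOn S (k + l) t v
  done           ++ᵣ q = q
  step rot st p  ++ᵣ q = step rot st (p ++ᵣ q)

  _∷ʳᵣ_ : ∀ {S k t u v} → RotPathOn S k t u → Rotation u v × IsSearchTree G S v → RotPathOn S (suc k) t v
  done          ∷ʳᵣ (rot , st) = step rot st done
  step rot′ st′ p ∷ʳᵣ last     = step rot′ st′ (p ∷ʳᵣ last)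

  reverseᵣ : ∀ {S k t u} → IsSearchTree G S t → RotPathOn S k t u → RotPathOn S k u t
  reverseᵣ st done            = done
  reverseᵣ st (step rot su p) = reverseᵣ su p ∷ʳᵣ (Rotation-sym rot , st)

  retarget : ∀ {S k t u u′} → RotPathOn S (suc k) t u → SameTubes u u′ → IsSearchTree G S u′ →
    RotPathOn S (suc k) t u′
  retarget (step rot _ done)         u≈u′ st′ = step (Rotation-respʳ u≈u′ rot) st′ done
  retarget (step rot st (step r s p)) u≈u′ st′ = step rot st (retarget (step r s p) u≈u′ st′)

  searchTree-replace : ∀ {S r} ls {c d rs} → IsSearchTree G S (node r (ls ++ c ∷ rs)) →
    IsSearchTree G (verts c) d → verts d ≡ verts c → IsSearchTree G S (node r (ls ++ d ∷ rs))
  searchTree-replace {S} {r} ls {c} {d} {rs} (node _ _ r∈ cs cover disjoint) st d≡c =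
    node r _ r∈ (All.++⁺ (All.++⁻ˡ ls cs) (d-on ∷ All.tail (All.++⁻ʳ ls cs)))
      (λ v v∈ → replace-any (cover v v∈))
      (replace-pairs ls disjoint)
    where
    d-on : Component G (S - r) (verts d) × IsSearchTree G (verts d) d
    d-on = subst (Component G (S - r)) (sym d≡c) (proj₁ (All.head (All.++⁻ʳ ls cs))) ,
           subst (λ X → IsSearchTree G X d) (sym d≡c) st
    replace-any : ∀ {v} → Any (λ e → v ∈ verts e) (ls ++ c ∷ rs) → Any (λ e → v ∈ verts e) (ls ++ d ∷ rs)
    replace-any v∈ with Any.++⁻ ls v∈
    ... | inj₁ v∈ls        = Any.++⁺ˡ v∈ls
    ... | inj₂ (here v∈c)  = Any.++⁺ʳ ls (here (subst (_ ∈_) (sym d≡c) v∈c))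
    ... | inj₂ (there v∈rs) = Any.++⁺ʳ ls (there v∈rs)
    d#-resp : ∀ e → Disjoint c e → Disjoint d e
    d#-resp _ c#e (x , x∈) = c#e (x , subst (λ X → x ∈ X ∩ _) d≡c x∈)
    #d-resp : ∀ e → Disjoint e c → Disjoint e d
    #d-resp _ e#c (x , x∈) = e#c (x , subst (λ X → x ∈ _ ∩ X) d≡c x∈)
    replace-pairs : ∀ ks → AllPairs Disjoint (ks ++ c ∷ rs) → AllPairs Disjoint (ks ++ d ∷ rs)
    replace-pairs []       (c# ∷ ps) = All.map (λ {e} → d#-resp e) c# ∷ ps
    replace-pairs (k ∷ ks) (k# ∷ ps) =
      All.++⁺ (All.++⁻ˡ ks k#) (#d-resp k (All.head (All.++⁻ʳ ks k#)) ∷ All.tail (All.++⁻ʳ ks k#)) ∷ replace-pairs ks ps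

  lift-path : ∀ {S r} ls rs {C k c d} → IsSearchTree G S (node r (ls ++ c ∷ rs)) → IsSearchTree G C c →
    RotPathOn C k c d → RotPathOn S k (node r (ls ++ c ∷ rs)) (node r (ls ++ d ∷ rs)) × IsSearchTree G S (node r (ls ++ d ∷ rs))
  lift-path ls rs st sc done = done , st
  lift-path {S} {r} ls rs {c = c} st sc (step {u = e} rot se p) =
    let path , st′ = lift-path ls rs st-e se p
    in  step (Rotation-child ls rs (sym e≡c) r∉c (∉vertsList-left ls disjoint) (∉vertsList-right ls disjoint) rot) st-e path , st′
    where
    disjoint : AllPairs Disjoint (ls ++ c ∷ rs)
    disjoint = subtrees-disjoint st
    e≡c : verts e ≡ verts c
    e≡c = trans (verts-searchTree se) (sym (verts-searchTree sc))
    st-e : IsSearchTree G S (node r (ls ++ e ∷ rs))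
    st-e = searchTree-replace ls st (subst (λ X → IsSearchTree G X e) (sym (verts-searchTree sc)) se) e≡c
    r∉c : r ∉ verts c
    r∉c r∈c = root∉subtrees st (x∈vertsList⁺ (Any.++⁺ʳ ls (here r∈c)))

-- Rotating a universal vertex past its parent

  Adjacent : Fin n → RTree n → Set
  Adjacent a c = ∃ λ x → x ∈ verts c × adj G a x ≡ true

  adjacent? : ∀ a c → Dec (Adjacent a c)
  adjacent? a c = any? λ x → (x ∈? verts c) ×-dec (adj G a x ≟ᵇ true)

  subtrees-within : ∀ (ds : List (RTree n)) → All (λ d → verts d ⊆ vertsList ds) ds
  subtrees-within []       = []
  subtrees-within (d ∷ ds) = x∈p∪q⁺ˡ ∷ All.map (λ d⊆ {x} x∈ → x∈p∪q⁺ʳ (d⊆ x∈)) (subtrees-within ds)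

  -- Promoting w above a: the subtrees below w adjacent to a stay with a, the others move up to w.
  module Promote {S a w cs} (universal : Universal G S w) (a≢w : a ≢ w)
                 (st : IsSearchTree G S (node a (node w cs ∷ []))) where

    ds es : List (RTree n)
    ds = filter (adjacent? a) cs
    es = filter (¬? ∘ adjacent? a) cs

    split : Interleaving ds es cs
    split = filter⁺ (adjacent? a) cs

    V Y : Subset n
    V = verts (node w cs)
    Y = verts (node a ds)

    V-on : Component G (S - a) V
    V-on = proj₁ (All.head (subtrees st))
    stV : IsSearchTree G V (node w cs)
    stV = proj₂ (All.head (subtrees st))

    V⇒S : ∀ {x} → x ∈ V → x ∈ S × x ≢ a
    V⇒S x∈ = x∈p-y⁻ (proj₁ V-on x∈)

    S⇒V : ∀ {x} → x ∈ S → x ≢ a → x ∈ V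
    S⇒V x∈ x≢a with x∈vertsList⁻ (node w cs ∷ []) (subst (_ ∈_) (sym (vertsList-subtrees st)) (x∈p∧x≢y⇒x∈p-y x∈ x≢a))
    ... | here x∈V = x∈V

    w∈S : w ∈ S
    w∈S = proj₁ (V⇒S (root∈ stV))

    cs⇒V-w : ∀ {x} → x ∈ vertsList cs → x ∈ V - w
    cs⇒V-w = SubtreesOn⇒⊆ (subtrees stV)

    a∉cs : a ∉ vertsList cs
    a∉cs a∈ = proj₂ (V⇒S (proj₁ (x∈p-y⁻ (cs⇒V-w a∈)))) refl

    S-w⇒V-w : ∀ {v} → v ∈ S - w → v ≢ a → v ∈ V - w
    S-w⇒V-w v∈ v≢a = let v∈S , v≢w = x∈p-y⁻ v∈ in x∈p∧x≢y⇒x∈p-y (S⇒V v∈S v≢a) v≢w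

    Y⇒S-w : ∀ {x} → x ∈ Y → x ∈ S - w
    Y⇒S-w x∈ with x∈p∪q⁻ ⁅ a ⁆ _ x∈
    ... | inj₁ x∈a  rewrite x∈⁅y⁆⇒x≡y a x∈a = x∈p∧x≢y⇒x∈p-y (root∈ st) a≢w
    ... | inj₂ x∈ds = let x∈V , x≢w = x∈p-y⁻ (cs⇒V-w (vertsList-interleaving⁺ˡ split x∈ds))
                      in  x∈p∧x≢y⇒x∈p-y (proj₁ (V⇒S x∈V)) x≢w

    ds-on : All (λ d → (Adjacent a d × Component G (V - w) (verts d)) × verts d ⊆ vertsList ds) ds
    ds-on = All.zip (All.zip (All.all-filter (adjacent? a) cs , All.map proj₁ (All-interleaving⁻ˡ split (subtrees stV))) ,
                    subtrees-within ds)

    walk-from-a : ∀ y → y ∈ Y → Walk G Y a y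
    walk-from-a y y∈ with x∈p∪q⁻ ⁅ a ⁆ _ y∈
    ... | inj₁ y∈a rewrite x∈⁅y⁆⇒x≡y a y∈a = here y∈
    ... | inj₂ y∈ds with All.lookupAny ds-on (x∈vertsList⁻ ds y∈ds)
    ... | (((z , z∈ , az) , (_ , (_ , walk) , _)) , d⊆) , y∈d =
      step (rootOf∈verts (node a ds)) az (walk-mono (x∈p∪q⁺ʳ ∘ d⊆) (walk z y z∈ y∈d))

    Y-closed : ∀ u v → u ∈ Y → v ∈ S - w → adj G u v ≡ true → v ∈ Y
    Y-closed u v u∈ v∈ uv with v ≟ a
    ... | yes refl = rootOf∈verts (node a ds)
    ... | no v≢a with x∈p∪q⁻ ⁅ a ⁆ _ u∈
    ... | inj₁ u∈a rewrite x∈⁅y⁆⇒x≡y a u∈a with Any-interleaving⁻ split (subtrees-cover stV v (S-w⇒V-w v∈ v≢a))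
    ...   | inj₁ v∈ds = x∈p∪q⁺ʳ (x∈vertsList⁺ v∈ds)
    ...   | inj₂ v∈es = let ¬adj , v∈e = All.lookupAny (All.all-filter (¬? ∘ adjacent? a) cs) v∈es
                        in  ⊥-elim (¬adj (v , v∈e , uv))
    Y-closed u v u∈ v∈ uv | no v≢a | inj₂ u∈ds with All.lookupAny ds-on (x∈vertsList⁻ ds u∈ds)
    ... | ((_ , (_ , _ , closed)) , d⊆) , u∈d = x∈p∪q⁺ʳ (d⊆ (closed u v u∈d (S-w⇒V-w v∈ v≢a) uv))

    Y-on : Component G (S - w) Y
    Y-on = Y⇒S-w , connected-from a (rootOf∈verts (node a ds)) walk-from-a , Y-closed

    stY : IsSearchTree G Y (node a ds)
    stY = node a ds (rootOf∈verts (node a ds)) ds-subtrees (λ v v∈ → x∈vertsList⁻ ds (Y-a⇒ds v∈))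
            (AllPairs-interleaving⁻ˡ split (subtrees-disjoint stV))
      where
      Y-a⇒ds : ∀ {x} → x ∈ Y - a → x ∈ vertsList ds
      Y-a⇒ds x∈ with x∈p-y⁻ x∈
      ... | x∈Y , x≢a with x∈p∪q⁻ ⁅ a ⁆ _ x∈Y
      ... | inj₁ x∈a  = ⊥-elim (x≢a (x∈⁅y⁆⇒x≡y a x∈a))
      ... | inj₂ x∈ds = x∈ds
      ds-subtrees : SubtreesOn (Y - a) ds
      ds-subtrees = All.map
        (λ { ((C , st′) , d⊆) →
             component-shrink C
               (λ x∈ → let x∈cs = vertsList-interleaving⁺ˡ split (d⊆ x∈)
                       in  x∈p∧x≢y⇒x∈p-y (x∈p∪q⁺ʳ (d⊆ x∈)) λ { refl → a∉cs x∈cs })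
               (cs⇒V-w ∘ vertsList-interleaving⁺ˡ split ∘ Y-a⇒ds) , st′ })
        (All.zip (All-interleaving⁻ˡ split (subtrees stV) , subtrees-within ds))

    es-subtrees : SubtreesOn (S - w) es
    es-subtrees = All.map lift (All.zip (All-interleaving⁻ʳ split (subtrees stV) , All.all-filter (¬? ∘ adjacent? a) cs))
      where
      lift : ∀ {e} → (Component G (V - w) (verts e) × IsSearchTree G (verts e) e) × ¬ Adjacent a e →
        Component G (S - w) (verts e) × IsSearchTree G (verts e) e
      lift {e} (((e⊆ , connected , closed) , st′) , ¬adj) =
        ((λ x∈ → let x∈V , x≢w = x∈p-y⁻ (e⊆ x∈) in x∈p∧x≢y⇒x∈p-y (proj₁ (V⇒S x∈V)) x≢w) , connected , closed′) , st′
        where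
        closed′ : ∀ u v → u ∈ verts e → v ∈ S - w → adj G u v ≡ true → v ∈ verts e
        closed′ u v u∈ v∈ uv with v ≟ a
        ... | yes refl = ⊥-elim (¬adj (u , u∈ , adj-sym uv))
        ... | no v≢a   = closed u v u∈ (S-w⇒V-w v∈ v≢a) uv

    cover : ∀ v → v ∈ S - w → Any (λ c → v ∈ verts c) (node a ds ∷ es)
    cover v v∈ with v ≟ a
    ... | yes refl = here (rootOf∈verts (node a ds))
    ... | no v≢a with Any-interleaving⁻ split (subtrees-cover stV v (S-w⇒V-w v∈ v≢a))
    ... | inj₁ v∈ds = here (x∈p∪q⁺ʳ (x∈vertsList⁺ v∈ds))
    ... | inj₂ v∈es = there v∈es

    disjoint : AllPairs Disjoint (node a ds ∷ es)
    disjoint = All.map (λ {e} → Y#e e) (subtrees-within es) ∷ AllPairs-interleaving⁻ʳ split (subtrees-disjoint stV)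
      where
      Y#e : ∀ e → verts e ⊆ vertsList es → Disjoint (node a ds) e
      Y#e e e⊆ (x , x∈) with x∈p∩q⁻ Y (verts e) x∈
      ... | x∈Y , x∈e with x∈p∪q⁻ ⁅ a ⁆ _ x∈Y
      ... | inj₁ x∈a rewrite x∈⁅y⁆⇒x≡y a x∈a = a∉cs (vertsList-interleaving⁺ʳ split (e⊆ x∈e))
      ... | inj₂ x∈ds = interleaving-disjoint split (subtrees-disjoint stV) x∈ds (e⊆ x∈e)

    promoted : IsSearchTree G S (node w (node a ds ∷ es))
    promoted = node w _ w∈S ((Y-on , stY) ∷ es-subtrees) cover disjoint

    promote : Rotation (node a (node w cs ∷ [])) (node w (node a ds ∷ es))
    promote = Rotation-promote a≢w a∉cs (root∉subtrees stV) split

  module Demote {S a w ds es} (universal : Universal G S w)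
                (st : IsSearchTree G S (node w (node a ds ∷ es))) where

    cs : List (RTree n)
    cs = ds ++ es

    split : Interleaving ds es cs
    split = ++-linear ds es

    Y V : Subset n
    Y = verts (node a ds)
    V = verts (node w cs)

    Y-on : Component G (S - w) Y
    Y-on = proj₁ (All.head (subtrees st))
    stY : IsSearchTree G Y (node a ds)
    stY = proj₂ (All.head (subtrees st))
    es-on : SubtreesOn (S - w) es
    es-on = All.tail (subtrees st)

    a∈Y : a ∈ Y
    a∈Y = rootOf∈verts (node a ds)
    a∈S : a ∈ S
    a∈S = proj₁ (x∈p-y⁻ (proj₁ Y-on a∈Y))
    a≢w : a ≢ w
    a≢w = proj₂ (x∈p-y⁻ (proj₁ Y-on a∈Y))

    Y∉es : ∀ {x} → x ∈ Y → x ∉ vertsList es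
    Y∉es = Disjoint⇒∉vertsList {c = node a ds} (AllPairs.head (subtrees-disjoint st))

    cs⇒S-w : ∀ {x} → x ∈ vertsList cs → x ∈ S - w
    cs⇒S-w x∈ with vertsList-interleaving⁻ split x∈
    ... | inj₁ x∈ds = proj₁ Y-on (x∈p∪q⁺ʳ x∈ds)
    ... | inj₂ x∈es = SubtreesOn⇒⊆ es-on x∈es

    a∉cs : a ∉ vertsList cs
    a∉cs a∈ with vertsList-interleaving⁻ split a∈
    ... | inj₁ a∈ds = root∉subtrees stY a∈ds
    ... | inj₂ a∈es = Y∉es a∈Y a∈es

    w∉cs : w ∉ vertsList cs
    w∉cs w∈ = proj₂ (x∈p-y⁻ (cs⇒S-w w∈)) refl

    V⇒S-a : ∀ {x} → x ∈ V → x ∈ S - a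
    V⇒S-a x∈ with x∈p∪q⁻ ⁅ w ⁆ _ x∈
    ... | inj₁ x∈w rewrite x∈⁅y⁆⇒x≡y w x∈w = x∈p∧x≢y⇒x∈p-y (root∈ st) (a≢w ∘ sym)
    ... | inj₂ x∈cs = x∈p∧x≢y⇒x∈p-y (proj₁ (x∈p-y⁻ (cs⇒S-w x∈cs))) λ { refl → a∉cs x∈cs }

    S-a⇒V : ∀ {v} → v ∈ S - a → v ∈ V
    S-a⇒V {v} v∈ with v ≟ w
    ... | yes refl = rootOf∈verts (node w cs)
    ... | no v≢w with subtrees-cover st v (x∈p∧x≢y⇒x∈p-y (proj₁ (x∈p-y⁻ v∈)) v≢w)
    ... | there v∈es = x∈p∪q⁺ʳ (vertsList-interleaving⁺ʳ split (x∈vertsList⁺ v∈es))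
    ... | here v∈Y with x∈p∪q⁻ ⁅ a ⁆ _ v∈Y
    ...   | inj₁ v∈a  = ⊥-elim (proj₂ (x∈p-y⁻ v∈) (x∈⁅y⁆⇒x≡y a v∈a))
    ...   | inj₂ v∈ds = x∈p∪q⁺ʳ (vertsList-interleaving⁺ˡ split v∈ds)

    -- S - a is connected through the universal vertex w, so V is all of it.
    V-on : Component G (S - a) V
    V-on = V⇒S-a , connected-from w (rootOf∈verts (node w cs)) walk-from-w , λ _ v _ v∈ _ → S-a⇒V v∈
      where
      walk-from-w : ∀ y → y ∈ V → Walk G V w y
      walk-from-w y y∈ with y ≟ w
      ... | yes refl = here y∈
      ... | no y≢w   = step (rootOf∈verts (node w cs)) (universal y (proj₁ (x∈p-y⁻ (V⇒S-a y∈))) y≢w) (here y∈)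

    V-w⇒cs : ∀ {x} → x ∈ V - w → x ∈ vertsList cs
    V-w⇒cs x∈ with x∈p-y⁻ x∈
    ... | x∈V , x≢w with x∈p∪q⁻ ⁅ w ⁆ _ x∈V
    ... | inj₁ x∈w  = ⊥-elim (x≢w (x∈⁅y⁆⇒x≡y w x∈w))
    ... | inj₂ x∈cs = x∈cs

    cs⇒V-w : ∀ {x} → x ∈ vertsList cs → x ∈ V - w
    cs⇒V-w x∈ = x∈p∧x≢y⇒x∈p-y (x∈p∪q⁺ʳ x∈) λ { refl → w∉cs x∈ }

    ds-subtrees : SubtreesOn (V - w) ds
    ds-subtrees = All.map lift (All.zip (subtrees stY , subtrees-within ds))
      where
      lift : ∀ {d} → (Component G (Y - a) (verts d) × IsSearchTree G (verts d) d) × verts d ⊆ vertsList ds →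
        Component G (V - w) (verts d) × IsSearchTree G (verts d) d
      lift {d} (((_ , connected , closed) , st′) , d⊆) =
        ((λ x∈ → cs⇒V-w (vertsList-interleaving⁺ˡ split (d⊆ x∈))) , connected , closed′) , st′
        where
        closed′ : ∀ u v → u ∈ verts d → v ∈ V - w → adj G u v ≡ true → v ∈ verts d
        closed′ u v u∈ v∈ uv with vertsList-interleaving⁻ split (V-w⇒cs v∈)
        ... | inj₁ v∈ds = closed u v u∈ (x∈p∧x≢y⇒x∈p-y (x∈p∪q⁺ʳ v∈ds) λ { refl → root∉subtrees stY v∈ds }) uv
        ... | inj₂ v∈es with All.lookupAny (All.zip (es-on , subtrees-within es)) (x∈vertsList⁻ es v∈es)
        ...   | (((_ , _ , closedₑ) , _) , e⊆) , v∈e =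
          ⊥-elim (Y∉es (x∈p∪q⁺ʳ (d⊆ u∈)) (e⊆ (closedₑ v u v∈e (proj₁ Y-on (x∈p∪q⁺ʳ (d⊆ u∈))) (adj-sym uv))))

    es-subtrees : SubtreesOn (V - w) es
    es-subtrees = All.map
      (λ { ((C , st′) , e⊆) →
           component-shrink C (λ x∈ → cs⇒V-w (vertsList-interleaving⁺ʳ split (e⊆ x∈)))
             (λ x∈ → let x∈V , x≢w = x∈p-y⁻ x∈ in x∈p∧x≢y⇒x∈p-y (proj₁ (x∈p-y⁻ (V⇒S-a x∈V))) x≢w) , st′ })
      (All.zip (es-on , subtrees-within es))

    cs-disjoint : AllPairs Disjoint cs
    cs-disjoint = AllPairs.++⁺ (subtrees-disjoint stY) (AllPairs.tail (subtrees-disjoint st))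
      (All.map (λ {d} (d⊆ : verts d ⊆ vertsList ds) → All.map (λ {e} → ds#es d e d⊆) (subtrees-within es)) (subtrees-within ds))
      where
      ds#es : ∀ d e → verts d ⊆ vertsList ds → verts e ⊆ vertsList es → Disjoint d e
      ds#es d e d⊆ e⊆ (x , x∈) = let x∈d , x∈e = x∈p∩q⁻ (verts d) (verts e) x∈ in Y∉es (x∈p∪q⁺ʳ (d⊆ x∈d)) (e⊆ x∈e)

    stV : IsSearchTree G V (node w cs)
    stV = node w cs (rootOf∈verts (node w cs)) (All.++⁺ ds-subtrees es-subtrees)
            (λ v v∈ → x∈vertsList⁻ cs (V-w⇒cs v∈)) cs-disjoint

    demoted : IsSearchTree G S (node a (node w cs ∷ []))
    demoted = node a _ a∈S ((V-on , stV) ∷ []) (λ v v∈ → here (S-a⇒V v∈)) ([] ∷ [])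

    demote : Rotation (node w (node a ds ∷ es)) (node a (node w cs ∷ []))
    demote = Rotation-sym (Rotation-promote a≢w a∉cs w∉cs split)

-- Distances between search trees on a graph with a universal vertex

  -- Each rotation pulls w above its parent, a neighbour of w that leaves the part of the tree still
  -- containing w; so there are at most degree-many rotations.
  pull-to-root : ∀ {S w} → Universal G S w → w ∈ S → ∀ t → IsSearchTree G S t →
    ∃ λ k → k ≤ degree G S w × ∃ λ ts → RotPathOn S k t (node w ts) × IsSearchTree G S (node w ts)
  pull-to-root {S} {w} universal w∈S (node a cs) st with a ≟ w
  ... | yes refl = 0 , z≤n , cs , done , st
  pull-to-root universal w∈S (node a []) st | no a≢w
    with () ← subtrees-cover st _ (x∈p∧x≢y⇒x∈p-y w∈S (a≢w ∘ sym))
  pull-to-root {w = w} universal w∈S (node a (c ∷ c′ ∷ _)) st | no a≢w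
    with (C , _) ∷ (C′ , _) ∷ _ ← subtrees st =
    let w∈ = x∈p∧x≢y⇒x∈p-y w∈S (a≢w ∘ sym)
    in  ⊥-elim (All.head (AllPairs.head (subtrees-disjoint st))
          (w , x∈p∩q⁺ (component-∋-universal universal w∈ C , component-∋-universal universal w∈ C′)))
  pull-to-root {S} {w} universal w∈S (node a (c ∷ [])) st | no a≢w =
    let stc = proj₂ (All.head (subtrees st))
        k , k≤ , ts , path , _ = pull-to-root universal-c w∈c c stc
        lifted , st″ = lift-path [] [] st stc path
        open Promote universal a≢w st″
    in  suc k , bound k≤ , _ , lifted ∷ʳᵣ (promote , promoted) , promoted
    where
    c≡S-a : verts c ≡ S - a
    c≡S-a = trans (sym (∪-identityʳ (verts c))) (vertsList-subtrees st)
    universal-c : Universal G (verts c) w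
    universal-c x x∈ = universal x (proj₁ (x∈p-y⁻ (subst (x ∈_) c≡S-a x∈)))
    w∈c : w ∈ verts c
    w∈c = subst (w ∈_) (sym c≡S-a) (x∈p∧x≢y⇒x∈p-y w∈S (a≢w ∘ sym))
    bound : ∀ {k} → k ≤ degree G (verts c) w → suc k ≤ degree G S w
    bound {k} k≤ = ≤-trans (≤-reflexive (+-comm 1 k))
      (≤-trans (+-monoˡ-≤ 1 (subst (λ X → k ≤ degree G X w) c≡S-a k≤))
               (degree-remove G (root∈ st) (universal a (root∈ st) a≢w)))

  -- Trees with the same tubes differ only in the order of subtrees and are the same vertex of the
  -- associahedron, so the bound is stated up to this identification.
  TubeDiameterAtMost : Subset n → ℕ → Set
  TubeDiameterAtMost S d = ∀ t t′ → IsSearchTree G S t → IsSearchTree G S t′ →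
    ∃ λ k → k ≤ d × ∃ λ t″ → RotPathOn S k t t″ × SameTubes t″ t′

  join-SameTubes : ∀ {S k l t u u′ v} → RotPathOn S k t u → SameTubes u u′ → RotPathOn S l u′ v →
    ∃ λ v′ → RotPathOn S (k + l) t v′ × SameTubes v′ v
  join-SameTubes {k = k} p u≈u′ done = _ , subst (λ m → RotPathOn _ m _ _) (sym (+-identityʳ k)) p , u≈u′
  join-SameTubes p u≈u′ (step rot st q) =
    _ , p ++ᵣ step (Rotation-respˡ (SameTubes-sym u≈u′) rot) st q , SameTubes-refl

  Matches : List (RTree n) → RTree n → Set
  Matches ts′ c = ∃ λ q → q ∈ₗ ts′ × SameTubes c q

  subtree-unique : ∀ {ts : List (RTree n)} {p q x} → AllPairs Disjoint ts → p ∈ₗ ts → q ∈ₗ ts → x ∈ verts p → x ∈ verts q → p ≡ q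
  subtree-unique _         (here refl) (here refl) _   _   = refl
  subtree-unique (p# ∷ _)  (here refl) (there q∈) x∈p x∈q = ⊥-elim (All.lookup p# q∈ (_ , x∈p∩q⁺ (x∈p , x∈q)))
  subtree-unique (q# ∷ _)  (there p∈) (here refl) x∈p x∈q = ⊥-elim (All.lookup q# p∈ (_ , x∈p∩q⁺ (x∈q , x∈p)))
  subtree-unique (_ ∷ ps)  (there p∈) (there q∈) x∈p x∈q = subtree-unique ps p∈ q∈ x∈p x∈q

  SameTubes-matched : ∀ {S w fin ts′} → IsSearchTree G S (node w fin) → IsSearchTree G S (node w ts′) →
    All (Matches ts′) fin → SameTubes (node w fin) (node w ts′)
  SameTubes-matched {S} {w} {fin} {ts′} st st′ matched Z = mk⇔ forth back
    where
    same-verts : verts (node w fin) ≡ verts (node w ts′)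
    same-verts = trans (verts-searchTree st) (sym (verts-searchTree st′))
    forth : IsTube (node w fin) Z → IsTube (node w ts′) Z
    forth (root _)  = subst (IsTube (node w ts′)) (sym same-verts) (root _)
    forth (child τ) =
      let (q , q∈ , c≈q) , τ′ = All.lookupAny matched τ
      in  child (lose q∈ (to (c≈q Z) τ′))
    back : IsTube (node w ts′) Z → IsTube (node w fin) Z
    back (root _)  = subst (IsTube (node w fin)) same-verts (root _)
    back (child τ) =
      let p , p∈ , τp = find τ
          r∈S-w = SubtreesOn⇒⊆ (subtrees st′) (x∈vertsList⁺ (lose p∈ (rootOf∈verts p)))
          c , c∈ , r∈c = find (subtrees-cover st (rootOf p) r∈S-w)
          q , q∈ , c≈q = All.lookup matched c∈
          q≡p = subtree-unique (subtrees-disjoint st′) q∈ p∈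
                  (subst (_ ∈_) (SameTubes⇒verts≡ c≈q) r∈c) (rootOf∈verts p)
      in  child (lose c∈ (from (c≈q Z) (subst (λ q → IsTube q Z) (sym q≡p) τp)))

  -- The subtrees in rest are replaced one at a time, using the hypothesis inside each component of S - w.
  align-subtrees : ∀ {S w ts′} → IsSearchTree G S (node w ts′) →
    (∀ {C} → Component G (S - w) C → TubeDiameterAtMost C (arcs G C)) →
    ∀ pre rest → IsSearchTree G S (node w (pre ++ rest)) → All (Matches ts′) pre →
    ∃ λ k → k ≤ arcsList G rest × ∃ λ fin →
      RotPathOn S k (node w (pre ++ rest)) (node w fin) × IsSearchTree G S (node w fin) × All (Matches ts′) fin
  align-subtrees st′ diameter pre [] st matched = 0 , z≤n , pre ++ [] , done , st , All.++⁺ matched []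
  align-subtrees {S} {w} {ts′} st′ diameter pre (c ∷ rest) st matched =
    let C-on , stc = All.head (All.++⁻ʳ pre (subtrees st))
        q , q∈ , r∈q = find (subtrees-cover st′ (rootOf c) (proj₁ C-on (rootOf∈verts c)))
        q-on , stq = All.lookup (subtrees st′) q∈
        c≡q = component-unique C-on q-on (rootOf∈verts c) r∈q
        k₁ , k₁≤ , c″ , path₁ , c″≈q = diameter C-on c q stc (subst (λ X → IsSearchTree G X q) (sym c≡q) stq)
        lifted , st₁ = lift-path pre rest st stc path₁
        k₂ , k₂≤ , fin , path₂ , st-fin , matched-fin =
          align-subtrees st′ diameter (pre ++ c″ ∷ []) rest
            (subst (λ ts → IsSearchTree G S (node w ts)) (sym (++-assoc pre _ rest)) st₁)
            (All.++⁺ matched ((q , q∈ , c″≈q) ∷ []))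
    in  k₁ + k₂ , +-mono-≤ k₁≤ k₂≤ , fin ,
        lifted ++ᵣ subst (λ ts → RotPathOn S k₂ (node w ts) (node w fin)) (++-assoc pre _ rest) path₂ ,
        st-fin , matched-fin

  diameter-universal : ∀ {S w} → w ∈ S → Universal G S w →
    (∀ {C} → Component G (S - w) C → TubeDiameterAtMost C (arcs G C)) → TubeDiameterAtMost S (arcs G S)
  diameter-universal {S} {w} w∈S universal diameter t t′ st st′ =
    let k₁ , k₁≤ , ts , path₁ , st₁ = pull-to-root universal w∈S t st
        k₂ , k₂≤ , ts′ , path₂ , st₂ = pull-to-root universal w∈S t′ st′
        k₃ , k₃≤ , fin , path₃ , st₃ , matched = align-subtrees st₂ diameter [] ts st₁ []
        t″ , path , t″≈t′ = join-SameTubes (path₁ ++ᵣ path₃) (SameTubes-matched st₃ st₂ matched) (reverseᵣ st′ path₂)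
        k₃≤′ = ≤-trans k₃≤ (≤-trans (arcsList-≤ G (subtrees-disjoint st₁)) (≤-reflexive (cong (arcs G) (vertsList-subtrees st₁))))
    in  k₁ + k₃ + k₂ , bound k₁≤ k₂≤ k₃≤′ , t″ , path , t″≈t′
    where
    open ≤-Reasoning
    bound : ∀ {k₁ k₂ k₃} → k₁ ≤ degree G S w → k₂ ≤ degree G S w → k₃ ≤ arcs G (S - w) → k₁ + k₃ + k₂ ≤ arcs G S
    bound {k₁} {k₂} {k₃} k₁≤ k₂≤ k₃≤ = begin
      k₁ + k₃ + k₂                                   ≡⟨ +-assoc k₁ k₃ k₂ ⟩
      k₁ + (k₃ + k₂)                                 ≡⟨ cong (k₁ +_) (+-comm k₃ k₂) ⟩
      k₁ + (k₂ + k₃)                                 ≡⟨ sym (+-assoc k₁ k₂ k₃) ⟩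
      k₁ + k₂ + k₃                                   ≤⟨ +-mono-≤ (+-mono-≤ k₁≤ k₂≤) k₃≤ ⟩
      degree G S w + degree G S w + arcs G (S - w)   ≤⟨ arcs-remove G w∈S ⟩
      arcs G S                                       ∎

-- Trivially perfect graphs

  diameter-subsingleton : ∀ {S} d → Subsingleton S → TubeDiameterAtMost S d
  diameter-subsingleton d trivial t t′ st st′ =
    0 , z≤n , t , done , subst (SameTubes t) (searchTree-singleton trivial st st′) SameTubes-refl

  NoEdges : Subset n → Subset n → Set
  NoEdges A B = ∀ a b → a ∈ A → b ∈ B → adj G a b ≡ false

  walk-stays : ∀ {A B C x y} → NoEdges A B → Walk G C x y → C ⊆ A ∪ B → x ∈ A → y ∈ A
  walk-stays no-edge (here _)      C⊆ x∈A = x∈A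
  walk-stays {A} no-edge (step _ xy w) C⊆ x∈A with x∈p∪q⁻ A _ (C⊆ (walk-start w))
  ... | inj₁ z∈A = walk-stays no-edge w C⊆ z∈A
  ... | inj₂ z∈B = case trans (sym xy) (no-edge _ _ x∈A z∈B) of λ ()

  component-∪ˡ : ∀ {A B C x} → NoEdges A B → Component G (A ∪ B) C → x ∈ C → x ∈ A → Component G A C
  component-∪ˡ no-edge C@(C⊆ , (_ , walk) , _) x∈C x∈A =
    component-shrink C (λ y∈C → walk-stays no-edge (walk _ _ x∈C y∈C) C⊆ x∈A) x∈p∪q⁺ˡ

  component-∪ʳ : ∀ {A B C x} → NoEdges A B → Component G (A ∪ B) C → x ∈ C → x ∈ B → Component G B C
  component-∪ʳ {A} {B} no-edge C x∈C x∈B =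
    component-∪ˡ (λ b a b∈ a∈ → trans (SimpleGraph.sym G b a) (no-edge a b a∈ b∈))
                 (subst (λ T → Component G T _) (∪-comm A B) C) x∈C x∈B

  cone-universal : ∀ {S : Subset n} {v} → (∀ u → u ∈ S → adj G v u ≡ true) → Universal G (S ∪ ⁅ v ⁆) v
  cone-universal {S} adj-v x x∈ x≢v with x∈p∪q⁻ S _ x∈
  ... | inj₁ x∈S = adj-v x x∈S
  ... | inj₂ x∈v = ⊥-elim (x≢v (x∈⁅y⁆⇒x≡y _ x∈v))

  component-universal : ∀ {S C v} → v ∈ S → Universal G S v → Component G S C → C ≡ S
  component-universal {S} {C} {v} v∈S universal C-on@(C⊆ , _ , closed) = ⊆-antisym C⊆ S⊆C
    where
    v∈C : v ∈ C
    v∈C with component-nonempty C-on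
    ... | x , x∈C with x ≟ v
    ... | yes refl = x∈C
    ... | no x≢v   = closed x v x∈C v∈S (adj-sym (universal x (C⊆ x∈C) x≢v))
    S⊆C : S ⊆ C
    S⊆C {y} y∈S with y ≟ v
    ... | yes refl = v∈C
    ... | no y≢v   = closed v y v∈C y∈S (universal y y∈S y≢v)

  cone-minus-apex : ∀ {S : Subset n} {v} → v ∉ S → (S ∪ ⁅ v ⁆) - v ≡ S
  cone-minus-apex {S} {v} v∉S = ⊆-antisym
    (λ x∈ → let x∈S∪v , x≢v = x∈p-y⁻ x∈ in
            [ (λ x∈S → x∈S) , (λ x∈v → ⊥-elim (x≢v (x∈⁅y⁆⇒x≡y v x∈v))) ]′ (x∈p∪q⁻ S _ x∈S∪v))
    (λ x∈S → x∈p∧x≢y⇒x∈p-y (x∈p∪q⁺ˡ x∈S) λ { refl → v∉S x∈S })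

  diameter-TP : ∀ {S C} → TP G S → Component G S C → TubeDiameterAtMost C (arcs G C)
  diameter-TP (single v) (C⊆ , _) =
    diameter-subsingleton _ λ x y x∈ y∈ → trans (x∈⁅y⁆⇒x≡y v (C⊆ x∈)) (sym (x∈⁅y⁆⇒x≡y v (C⊆ y∈)))
  diameter-TP (cone S v v∉S tp adj-v) C-on
    rewrite component-universal (x∈p∪q⁺ʳ (x∈⁅x⁆ v)) (cone-universal adj-v) C-on =
    diameter-universal (x∈p∪q⁺ʳ (x∈⁅x⁆ v)) (cone-universal adj-v)
      λ C′-on → diameter-TP tp (subst (λ T → Component G T _) (cone-minus-apex v∉S) C′-on)
  diameter-TP (union A B _ no-edge tpA tpB) C-on with component-nonempty C-on
  ... | x , x∈C with x∈p∪q⁻ A B (proj₁ C-on x∈C)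
  ... | inj₁ x∈A = diameter-TP tpA (component-∪ˡ no-edge C-on x∈C x∈A)
  ... | inj₂ x∈B = diameter-TP tpB (component-∪ʳ no-edge C-on x∈C x∈B)

  TP-nonempty : ∀ {S} → TP G S → ∃ λ x → x ∈ S
  TP-nonempty (single v)           = v , x∈⁅x⁆ v
  TP-nonempty (cone _ v _ _ _)     = v , x∈p∪q⁺ʳ (x∈⁅x⁆ v)
  TP-nonempty (union _ _ _ _ tp _) = let x , x∈ = TP-nonempty tp in x , x∈p∪q⁺ˡ x∈

  TP-single-or-cone : ∀ {S} → TP G S → Connected G S → Subsingleton S ⊎ ∃ λ w → w ∈ S × Universal G S w
  TP-single-or-cone (single v) _ = inj₁ λ x y x∈ y∈ → trans (x∈⁅y⁆⇒x≡y v x∈) (sym (x∈⁅y⁆⇒x≡y v y∈))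
  TP-single-or-cone (cone _ v _ _ adj-v) _ = inj₂ (v , x∈p∪q⁺ʳ (x∈⁅x⁆ v) , cone-universal adj-v)
  TP-single-or-cone (union A B A∩B≡∅ no-edge tpA tpB) (_ , walk) =
    let a , a∈A = TP-nonempty tpA
        b , b∈B = TP-nonempty tpB
        b∈A = walk-stays no-edge (walk a b (x∈p∪q⁺ˡ a∈A) (x∈p∪q⁺ʳ b∈B)) (λ x∈ → x∈) a∈A
    in  ⊥-elim (A∩B≡∅ (b , x∈p∩q⁺ (b∈A , b∈B)))

  rotation-neighbour : ∀ {S w x t} → w ∈ S → Universal G S w → x ∈ S → x ≢ w → IsSearchTree G S t →
    ∃ λ u → Rotation t u × IsSearchTree G S u
  rotation-neighbour {w = w} {t = t} w∈S universal x∈S x≢w st with pull-to-root universal w∈S t st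
  ... | _ , _ , _ , step rot su _ , _ = _ , rot , su
  ... | _ , _ , [] , done , st′ with () ← subtrees-cover st′ _ (x∈p∧x≢y⇒x∈p-y x∈S x≢w)
  ... | _ , _ , node a ds ∷ es , done , st′ = _ , Demote.demote universal st′ , Demote.demoted universal st′

  two-≤-arcs : ∀ {S w x} → w ∈ S → Universal G S w → x ∈ S → x ≢ w → 2 ≤ arcs G S
  two-≤-arcs {S} {w} {x} w∈S universal x∈S x≢w =
    ≤-trans (+-mono-≤ (+-mono-≤ one≤degree one≤degree) z≤n) (arcs-remove G w∈S)
    where
    one≤degree : 1 ≤ degree G S w
    one≤degree = subst (_≤ degree G S w) edge (≤-∑ (edgeInto G S w) x)
      where
      edge : edgeInto G S w x ≡ 1
      edge rewrite []=⇒lookup x∈S | universal x x∈S x≢w = refl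

  -- When the path found has length zero, its end has the tubes of t′ but may order subtrees
  -- differently; a detour through a neighbour of t then reaches t′ itself.
  reach-exactly : ∀ {S k t t″ t′} → TP G S → Connected G S → k ≤ arcs G S → RotPathOn S k t t″ →
    SameTubes t″ t′ → IsSearchTree G S t → IsSearchTree G S t′ → ∃ λ k′ → k′ ≤ arcs G S × RotPathOn S k′ t t′
  reach-exactly tp connected k≤ path@(step _ _ _) t″≈t′ st st′ = _ , k≤ , retarget path t″≈t′ st′
  reach-exactly {S} {t = t} tp connected _ done t≈t′ st st′ with TP-single-or-cone tp connected
  ... | inj₁ trivial = 0 , z≤n , subst (RotPathOn S 0 t) (searchTree-singleton trivial st st′) done
  ... | inj₂ (w , w∈S , universal) with any? (λ x → (x ∈? S) ×-dec ¬? (x ≟ w))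
  ...   | yes (x , x∈S , x≢w) =
    let u , rot , su = rotation-neighbour w∈S universal x∈S x≢w st
    in  2 , two-≤-arcs w∈S universal x∈S x≢w , step rot su (step (Rotation-respʳ t≈t′ (Rotation-sym rot)) st′ done)
  ...   | no no-other =
    0 , z≤n , subst (RotPathOn S 0 t) (searchTree-singleton (only-element no-other) st st′) done

RotPathOn⇒RotPath : ∀ {n} {G : SimpleGraph n} {k t u} → RotPathOn {G = G} ⊤ k t u → RotPath G k t u
RotPathOn⇒RotPath done              = done
RotPathOn⇒RotPath (step rot st path) = step rot st (RotPathOn⇒RotPath path)

theorem11 : ∀ {n} (G : SimpleGraph n) → Connected G ⊤ → TriviallyPerfect G →
    DiameterAtMost G (2 * numEdges G)
theorem11 G connected tp t t′ st st′ =
  let k , k≤ , t″ , path , t″≈t′ = diameter-TP tp (⊤-component connected) t t′ st st′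
      k′ , k′≤ , path′ = reach-exactly tp connected k≤ path t″≈t′ st st′
  in  k′ , ≤-trans k′≤ (arcs-⊤ G) , RotPathOn⇒RotPath path′
  where
  ⊤-component : Connected G ⊤ → Component G ⊤ ⊤
  ⊤-component connected = (λ x∈ → x∈) , connected , λ _ _ _ v∈ _ → v∈
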